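{- Let $G=(V,E)$ be a simple graph on $n$ vertices with Tutte matrix $T$, and let $T'$ be an evaluation of $T$ in which the variable $x_i$ (for an edge $i\in E$) has value $a_i$. Suppose there is $a\in\{1,\dots,n^{10}\}$ with $\operatorname{rank} T'_{x_i\gets a}=\operatorname{rank} T'+2$. Then for every value $\tilde a\neq a_i$ we have $\operatorname{rank} T'_{x_i\gets \tilde a}=\operatorname{rank} T'+2$.
   Context: With $V=\{1,\dots,n\}$ and edge variables $x_e$ ($e\in E$), the Tutte matrix $T$ is the skew-symmetric matrix with $T_{uv}=x_e$ if $u<v$, $e=\{u,v\}\in E$; $T_{uv}=-x_e$ if $u>v$, $e=\{u,v\}\in E$; and $0$ otherwise. An evaluation of $T$ substitutes a rational value for every variable. For an evaluation $T'$, $T'_{x_i\gets a}$ denotes the matrix obtained from $T'$ by changing the value of the variable $x_i$ (i.e. the two entries corresponding to edge $i$, with their signs) to $a$. -}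

module Defs where

open import Data.Nat as ℕ using (ℕ; zero; suc)
open import Data.Fin using (Fin; zero; suc; _<_)
open import Data.Fin.Properties using (_≟_; _<?_)
open import Data.Bool using (Bool; true; false; if_then_else_)
open import Data.Rational using (ℚ; 0ℚ; _+_; _*_; -_)
open import Data.Product using (Σ; ∃; _×_; _,_)
open import Relation.Binary.PropositionalEquality using (_≡_)
open import Relation.Nullary using (yes; no; ¬_)
open import Function.Definitions using (Injective)

record SimpleGraph (n : ℕ) : Set where
  field
    adj     : Fin n → Fin n → Bool
    symm    : ∀ u v → adj u v ≡ adj v u
    irrefl  : ∀ u → adj u u ≡ false
open SimpleGraph public

-- An edge {p,q} with p < q (each edge of G is represented exactly once).
record Edge {n : ℕ} (G : SimpleGraph n) : Set where
  constructor edge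
  field
    p q   : Fin n
    p<q   : p < q
    isAdj : adj G p q ≡ true
open Edge public

-- An evaluation of the edge variables: the variable of edge {u,v} (u < v)
-- has value val u v.  Entries with u ≥ v or non-edges are ignored.
Evaluation : ℕ → Set
Evaluation n = Fin n → Fin n → ℚ

Matrix : ℕ → Set
Matrix n = Fin n → Fin n → ℚ

tutte : ∀ {n} → SimpleGraph n → Evaluation n → Matrix n
tutte G val u v with adj G u v
... | false = 0ℚ
... | true with u <? v
...   | yes _ = val u v
...   | no _ with v <? u
...     | yes _ = - val v u
...     | no _  = 0ℚ

valueAt : ∀ {n} {G : SimpleGraph n} → Evaluation n → Edge G → ℚ
valueAt val e = val (p e) (q e)

setVar : ∀ {n} {G : SimpleGraph n} → Evaluation n → Edge G → ℚ → Evaluation n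
setVar val e a u v with u ≟ p e | v ≟ q e
... | yes _ | yes _ = a
... | _     | _     = val u v

sumℚ : ∀ {k} → (Fin k → ℚ) → ℚ
sumℚ {zero}  f = 0ℚ
sumℚ {suc k} f = f zero + sumℚ (λ i → f (suc i))

RowsIndependent : ∀ {n k} → Matrix n → (Fin k → Fin n) → Set
RowsIndependent {n} {k} M f =
  (c : Fin k → ℚ) → (∀ j → sumℚ (λ i → c i * M (f i) j) ≡ 0ℚ) → ∀ i → c i ≡ 0ℚ

HasRank : ∀ {n} → Matrix n → ℕ → Set
HasRank {n} M r =
  (Σ (Fin r → Fin n) λ f → Injective _≡_ _≡_ f × RowsIndependent M f)
  × (∀ k (f : Fin k → Fin n) → Injective _≡_ _≡_ f → RowsIndependent M f → k ℕ.≤ r)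

-- Setting x_e to x changes only rows p and q of T', by (x − a₀)·e_q and −(x − a₀)·e_p, so the
-- rank rises by at most 2. If r + 2 rows are independent at the value a, they must include rows
-- p and q, and the other r rows S are a basis of the row space of T'; so rows p and q of T' lie
-- in span S. With this, any relation among the same r + 2 rows at one nonzero shift x − a₀
-- rescales into a relation at any other nonzero shift, so these rows stay independent for all
-- ã ≠ a₀.
module Submission where

open import Defs
open import Data.Nat using (ℕ; zero; suc; _≤_; _^_; _+_; z≤n; s≤s)
import Data.Nat.Properties as ℕP
open import Data.Integer using (+_)
open import Data.Fin using (Fin; zero; suc; punchIn)
import Data.Fin.Properties as FinP
open import Data.Rational as Q using (ℚ; 0ℚ; 1ℚ; _*_; -_; _-_; 1/_; ≢-nonZero)
  renaming (_+_ to _+ℚ_)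
import Data.Rational.Properties as ℚP
open import Data.Rational.Solver using (module +-*-Solver)
open import Data.Product using (Σ; ∃; _×_; _,_; proj₁; proj₂)
open import Data.Empty using (⊥-elim)
open import Data.Bool using (true; false)
open import Data.Vec.Functional using (Vector; _∷_; head; tail; removeAt; insertAt; map)
open import Data.Vec.Functional.Properties using (insertAt-lookup; insertAt-punchIn; removeAt-insertAt)
open import Function using (_∘_)
open import Function.Definitions using (Injective)
open import Relation.Binary.PropositionalEquality
  using (_≡_; _≢_; _≗_; refl; sym; trans; cong; cong₂; subst; module ≡-Reasoning)
open import Relation.Nullary using (¬_; yes; no)
open import Algebra.Bundles using (Ring)
open import Algebra.Properties.Semiring.Sum (Ring.semiring ℚP.+-*-ring)
  using (sum; sum-cong-≗; sum-remove; ∑-distrib-+; *-distribˡ-sum)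

open +-*-Solver

private
  variable
    k m n : ℕ

x*y≡0⇒y≡0 : ∀ {x y} → x ≢ 0ℚ → x * y ≡ 0ℚ → y ≡ 0ℚ
x*y≡0⇒y≡0 {x} {y} x≢0 xy≡0 = begin
  y                ≡⟨ sym (ℚP.*-identityˡ y) ⟩
  1ℚ * y           ≡⟨ cong (_* y) (sym (ℚP.*-inverseˡ x)) ⟩
  (1/ x * x) * y   ≡⟨ ℚP.*-assoc (1/ x) x y ⟩
  1/ x * (x * y)   ≡⟨ cong (1/ x *_) xy≡0 ⟩
  1/ x * 0ℚ        ≡⟨ ℚP.*-zeroʳ (1/ x) ⟩
  0ℚ ∎
  where open ≡-Reasoning; instance _ = ≢-nonZero x≢0

x*y≢0 : ∀ {x y} → x ≢ 0ℚ → y ≢ 0ℚ → x * y ≢ 0ℚ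
x*y≢0 x≢0 y≢0 xy≡0 = y≢0 (x*y≡0⇒y≡0 x≢0 xy≡0)

x≢y⇒x-y≢0 : ∀ {x y} → x ≢ y → x - y ≢ 0ℚ
x≢y⇒x-y≢0 {x} {y} x≢y x-y≡0 = x≢y (begin
  x              ≡⟨ solve 2 (λ x y → x := (x :- y) :+ y) refl x y ⟩
  (x - y) +ℚ y   ≡⟨ cong (_+ℚ y) x-y≡0 ⟩
  0ℚ +ℚ y        ≡⟨ ℚP.+-identityˡ y ⟩
  y ∎)
  where open ≡-Reasoning

sumℚ≡sum : (f : Vector ℚ k) → sumℚ f ≡ sum f
sumℚ≡sum {zero}  f = refl
sumℚ≡sum {suc k} f = cong (f zero +ℚ_) (sumℚ≡sum (tail f))

sumℚ-cong : {f g : Vector ℚ k} → f ≗ g → sumℚ f ≡ sumℚ g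
sumℚ-cong {f = f} {g} f≗g = trans (sumℚ≡sum f) (trans (sum-cong-≗ f≗g) (sym (sumℚ≡sum g)))

sumℚ-remove : (f : Vector ℚ (suc k)) (i : Fin (suc k)) → sumℚ f ≡ f i +ℚ sumℚ (removeAt f i)
sumℚ-remove f i = begin
  sumℚ f                           ≡⟨ sumℚ≡sum f ⟩
  sum f                            ≡⟨ sum-remove {i = i} f ⟩
  f i +ℚ sum (removeAt f i)        ≡⟨ cong (f i +ℚ_) (sym (sumℚ≡sum (removeAt f i))) ⟩
  f i +ℚ sumℚ (removeAt f i) ∎
  where open ≡-Reasoning

combination : Vector ℚ k → Vector (Vector ℚ m) k → Vector ℚ m
combination c v j = sumℚ (λ i → c i * v i j)

combination-linear : ∀ a b (c d : Vector ℚ k) (v : Vector (Vector ℚ m) k) j →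
  combination (λ i → a * c i +ℚ b * d i) v j ≡ a * combination c v j +ℚ b * combination d v j
combination-linear {k} a b c d v j = begin
  sumℚ (λ i → (a * c i +ℚ b * d i) * v i j)
    ≡⟨ sumℚ-cong (λ i → distrib (c i) (d i) (v i j)) ⟩
  sumℚ (λ i → a * cv i +ℚ b * dv i)
    ≡⟨ sumℚ≡sum {k} _ ⟩
  sum (λ i → a * cv i +ℚ b * dv i)
    ≡⟨ ∑-distrib-+ (λ i → a * cv i) (λ i → b * dv i) ⟩
  sum (λ i → a * cv i) +ℚ sum (λ i → b * dv i)
    ≡⟨ sym (cong₂ _+ℚ_ (*-distribˡ-sum a cv) (*-distribˡ-sum b dv)) ⟩
  a * sum cv +ℚ b * sum dv
    ≡⟨ sym (cong₂ (λ x y → a * x +ℚ b * y) (sumℚ≡sum cv) (sumℚ≡sum dv)) ⟩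
  a * combination c v j +ℚ b * combination d v j ∎
  where
  open ≡-Reasoning
  cv dv : Vector ℚ _
  cv i = c i * v i j
  dv i = d i * v i j
  distrib : ∀ x y z → (a * x +ℚ b * y) * z ≡ a * (x * z) +ℚ b * (y * z)
  distrib = solve 5 (λ a b x y z → (a :* x :+ b :* y) :* z := a :* (x :* z) :+ b :* (y :* z)) refl a b

-- RowsIndependent M f unfolds to Independent (M ∘ f), so the lemmas below apply to it directly.
Independent : Vector (Vector ℚ m) k → Set
Independent v = ∀ c → (∀ j → combination c v j ≡ 0ℚ) → ∀ i → c i ≡ 0ℚ

-- Span membership with the denominator cleared (l ≠ 0), so that no division is needed.
_∈Span_ : Vector ℚ m → Vector (Vector ℚ m) k → Set
x ∈Span w = Σ ℚ λ l → l ≢ 0ℚ × Σ (Vector ℚ _) λ μ → ∀ j → l * x j +ℚ combination μ w j ≡ 0ℚ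

moveToFront : {A : Set} → Vector A (suc k) → Fin (suc k) → Vector A (suc k)
moveToFront v i = v i ∷ removeAt v i

Independent-cong : {v w : Vector (Vector ℚ m) k} → (∀ i j → v i j ≡ w i j) →
  Independent v → Independent w
Independent-cong v≡w ind c rel =
  ind c (λ j → trans (sumℚ-cong (λ i → cong (c i *_) (v≡w i j))) (rel j))

Independent-stable : {v : Vector (Vector ℚ m) k} → ¬ ¬ Independent v → Independent v
Independent-stable ¬¬ind c rel i with c i ℚP.≟ 0ℚ
... | yes cᵢ≡0 = cᵢ≡0
... | no  cᵢ≢0 = ⊥-elim (¬¬ind (λ ind → cᵢ≢0 (ind c rel i)))

Independent-tail : {x : Vector ℚ m} {w : Vector (Vector ℚ m) k} →
  Independent (x ∷ w) → Independent w
Independent-tail {x = x} {w} ind c rel i = ind (0ℚ ∷ c) rel′ (suc i)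
  where
  rel′ : ∀ j → 0ℚ * x j +ℚ combination c w j ≡ 0ℚ
  rel′ j = trans (cong (_+ℚ combination c w j) (ℚP.*-zeroˡ (x j)))
                 (trans (ℚP.+-identityˡ (combination c w j)) (rel j))

Independent-moveToFront : {v : Vector (Vector ℚ m) (suc k)} (i : Fin (suc k)) →
  Independent v → Independent (moveToFront v i)
Independent-moveToFront {v = v} i ind c rel = λ
  { zero    → trans (sym (insertAt-lookup (tail c) i (head c))) (c′≡0 i)
  ; (suc j) → trans (sym (insertAt-punchIn (tail c) i (head c) j)) (c′≡0 (punchIn i j))
  }
  where
  c′ = insertAt (tail c) i (head c)
  rel′ : ∀ j → combination c′ v j ≡ 0ℚ
  rel′ j = begin
    combination c′ v j
      ≡⟨ sumℚ-remove (λ l → c′ l * v l j) i ⟩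
    c′ i * v i j +ℚ combination (removeAt c′ i) (removeAt v i) j
      ≡⟨ cong₂ _+ℚ_ (cong (_* v i j) (insertAt-lookup (tail c) i (head c)))
                    (sumℚ-cong (λ l → cong (_* v (punchIn i l) j) (removeAt-insertAt (tail c) i (head c) l))) ⟩
    combination c (moveToFront v i) j
      ≡⟨ rel j ⟩
    0ℚ ∎
    where open ≡-Reasoning
  c′≡0 = ind c′ rel′

Independent-removeAt : {v : Vector (Vector ℚ m) (suc k)} (i : Fin (suc k)) →
  Independent v → Independent (removeAt v i)
Independent-removeAt {v = v} i = Independent-tail {x = v i} ∘ Independent-moveToFront {v = v} i

∉Span⇒Independent-∷ : {x : Vector ℚ m} {w : Vector (Vector ℚ m) k} →
  Independent w → ¬ (x ∈Span w) → Independent (x ∷ w)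
∉Span⇒Independent-∷ {x = x} {w} indw x∉ c rel with head c ℚP.≟ 0ℚ
... | no  c₀≢0 = ⊥-elim (x∉ (head c , c₀≢0 , tail c , rel))
... | yes c₀≡0 = λ { zero → c₀≡0 ; (suc i) → indw (tail c) relw i }
  where
  relw : ∀ j → combination (tail c) w j ≡ 0ℚ
  relw j = begin
    combination (tail c) w j                   ≡⟨ sym (ℚP.+-identityˡ _) ⟩
    0ℚ +ℚ combination (tail c) w j             ≡⟨ cong (_+ℚ _) (sym (ℚP.*-zeroˡ (x j))) ⟩
    0ℚ * x j +ℚ combination (tail c) w j       ≡⟨ cong (λ c₀ → c₀ * x j +ℚ combination (tail c) w j) (sym c₀≡0) ⟩
    combination c (x ∷ w) j                    ≡⟨ rel j ⟩
    0ℚ ∎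
    where open ≡-Reasoning

infixl 6 _+ᵛ_
infixl 7 _·ᵛ_

_+ᵛ_ : Vector ℚ m → Vector ℚ m → Vector ℚ m
(x +ᵛ y) j = x j +ℚ y j

_·ᵛ_ : ℚ → Vector ℚ m → Vector ℚ m
(s ·ᵛ x) j = s * x j

perturbation≢0 : {x d y : Vector ℚ m} {w : Vector (Vector ℚ m) k} {s : ℚ} →
  x ∈Span w → Independent ((x +ᵛ s ·ᵛ d) ∷ y ∷ w) → s ≢ 0ℚ
perturbation≢0 {x = x} {d} {y} {w} (l , l≢0 , μ , l·x+μ·w≡0) ind refl =
  l≢0 (ind (l ∷ 0ℚ ∷ μ) rel zero)
  where
  rel : ∀ j → l * (x j +ℚ 0ℚ * d j) +ℚ (0ℚ * y j +ℚ combination μ w j) ≡ 0ℚ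
  rel j = trans (solve 5 (λ l x d y Σ → l :* (x :+ con 0ℚ :* d) :+ (con 0ℚ :* y :+ Σ) := l :* x :+ Σ)
                         refl l (x j) (d j) (y j) (combination μ w j))
                (l·x+μ·w≡0 j)

perturbation-identity : ∀ x y d e Σt Σx Σy c₀ c₁ lx ly s s₀ →
  (lx * ly * s * c₀) * (x +ℚ s₀ * d) +ℚ ((lx * ly * s * c₁) * (y +ℚ s₀ * e)
    +ℚ (s₀ * (lx * ly) * Σt +ℚ (s - s₀) * ((c₀ * ly) * Σx +ℚ (c₁ * lx) * Σy)))
  ≡ s₀ * (lx * ly) * (c₀ * (x +ℚ s * d) +ℚ (c₁ * (y +ℚ s * e) +ℚ Σt))
    +ℚ (s - s₀) * (c₀ * ly * (lx * x +ℚ Σx) +ℚ c₁ * lx * (ly * y +ℚ Σy))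
perturbation-identity = solve 13 (λ x y d e Σt Σx Σy c₀ c₁ lx ly s s₀ →
  (lx :* ly :* s :* c₀) :* (x :+ s₀ :* d) :+ ((lx :* ly :* s :* c₁) :* (y :+ s₀ :* e)
    :+ (s₀ :* (lx :* ly) :* Σt :+ (s :- s₀) :* ((c₀ :* ly) :* Σx :+ (c₁ :* lx) :* Σy)))
  := s₀ :* (lx :* ly) :* (c₀ :* (x :+ s :* d) :+ (c₁ :* (y :+ s :* e) :+ Σt))
    :+ (s :- s₀) :* (c₀ :* ly :* (lx :* x :+ Σx) :+ c₁ :* lx :* (ly :* y :+ Σy))) refl

-- A relation c at s becomes one at s₀ after scaling by L·s (L = lx·ly) and correcting the
-- w-coefficients by (s − s₀) times the spanning relations of x and y; see perturbation-identity.
Independent-perturbation : {x y d e : Vector ℚ m} {w : Vector (Vector ℚ m) k} {s₀ s : ℚ} →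
  x ∈Span w → y ∈Span w → s ≢ 0ℚ →
  Independent ((x +ᵛ s₀ ·ᵛ d) ∷ (y +ᵛ s₀ ·ᵛ e) ∷ w) →
  Independent ((x +ᵛ s ·ᵛ d) ∷ (y +ᵛ s ·ᵛ e) ∷ w)
Independent-perturbation {k = k} {x = x} {y} {d} {e} {w} {s₀} {s}
  x∈w@(lx , lx≢0 , μx , hx) (ly , ly≢0 , μy , hy) s≢0 ind₀ c rel = λ
  { zero → c₀≡0 ; (suc zero) → c₁≡0 ; (suc (suc i)) → t≡0 i }
  where
  open ≡-Reasoning
  c₀ = c zero
  c₁ = c (suc zero)
  t = tail (tail c)
  L = lx * ly
  L≢0 = x*y≢0 lx≢0 ly≢0
  s₀≢0 : s₀ ≢ 0ℚ
  s₀≢0 = perturbation≢0 {d = d} {y +ᵛ s₀ ·ᵛ e} x∈w ind₀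
  ν : Vector ℚ k
  ν i = (c₀ * ly) * μx i +ℚ (c₁ * lx) * μy i
  c′ : Vector ℚ (suc (suc k))
  c′ = L * s * c₀ ∷ L * s * c₁ ∷ λ i → s₀ * L * t i +ℚ (s - s₀) * ν i
  rel′ : ∀ j → combination c′ ((x +ᵛ s₀ ·ᵛ d) ∷ (y +ᵛ s₀ ·ᵛ e) ∷ w) j ≡ 0ℚ
  rel′ j = begin
    L * s * c₀ * (x j +ℚ s₀ * d j) +ℚ (L * s * c₁ * (y j +ℚ s₀ * e j)
      +ℚ combination (λ i → s₀ * L * t i +ℚ (s - s₀) * ν i) w j)
      ≡⟨ cong (λ z → L * s * c₀ * (x j +ℚ s₀ * d j) +ℚ (L * s * c₁ * (y j +ℚ s₀ * e j) +ℚ z))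
           (trans (combination-linear (s₀ * L) (s - s₀) t ν w j)
                  (cong (λ z → s₀ * L * Σt +ℚ (s - s₀) * z)
                        (combination-linear (c₀ * ly) (c₁ * lx) μx μy w j))) ⟩
    L * s * c₀ * (x j +ℚ s₀ * d j) +ℚ (L * s * c₁ * (y j +ℚ s₀ * e j)
      +ℚ (s₀ * L * Σt +ℚ (s - s₀) * ((c₀ * ly) * Σx +ℚ (c₁ * lx) * Σy)))
      ≡⟨ perturbation-identity (x j) (y j) (d j) (e j) Σt Σx Σy c₀ c₁ lx ly s s₀ ⟩
    s₀ * L * combination c ((x +ᵛ s ·ᵛ d) ∷ (y +ᵛ s ·ᵛ e) ∷ w) j
      +ℚ (s - s₀) * (c₀ * ly * (lx * x j +ℚ Σx) +ℚ c₁ * lx * (ly * y j +ℚ Σy))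
      ≡⟨ cong₂ (λ r z → s₀ * L * r +ℚ (s - s₀) * z) (rel j)
               (cong₂ (λ a b → c₀ * ly * a +ℚ c₁ * lx * b) (hx j) (hy j)) ⟩
    s₀ * L * 0ℚ +ℚ (s - s₀) * (c₀ * ly * 0ℚ +ℚ c₁ * lx * 0ℚ)
      ≡⟨ solve 7 (λ s₀ L s c₀ c₁ lx ly →
           s₀ :* L :* con 0ℚ :+ (s :- s₀) :* (c₀ :* ly :* con 0ℚ :+ c₁ :* lx :* con 0ℚ) := con 0ℚ)
           refl s₀ L s c₀ c₁ lx ly ⟩
    0ℚ ∎
    where
    Σt = combination t w j
    Σx = combination μx w j
    Σy = combination μy w j
  c′≡0 = ind₀ c′ rel′
  c₀≡0 : c₀ ≡ 0ℚ
  c₀≡0 = x*y≡0⇒y≡0 (x*y≢0 L≢0 s≢0) (c′≡0 zero)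
  c₁≡0 : c₁ ≡ 0ℚ
  c₁≡0 = x*y≡0⇒y≡0 (x*y≢0 L≢0 s≢0) (c′≡0 (suc zero))
  t≡0 : ∀ i → t i ≡ 0ℚ
  t≡0 i = x*y≡0⇒y≡0 (x*y≢0 s₀≢0 L≢0) (begin
    s₀ * L * t i
      ≡⟨ solve 7 (λ a t b p u q v → a :* t := a :* t :+ b :* (con 0ℚ :* p :* u :+ con 0ℚ :* q :* v))
                 refl (s₀ * L) (t i) (s - s₀) ly (μx i) lx (μy i) ⟩
    s₀ * L * t i +ℚ (s - s₀) * (0ℚ * ly * μx i +ℚ 0ℚ * lx * μy i)
      ≡⟨ cong₂ (λ a b → s₀ * L * t i +ℚ (s - s₀) * (a * ly * μx i +ℚ b * lx * μy i))
               (sym c₀≡0) (sym c₁≡0) ⟩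
    s₀ * L * t i +ℚ (s - s₀) * ν i
      ≡⟨ c′≡0 (suc (suc i)) ⟩
    0ℚ ∎)

Injective-∷ : {x : Fin n} {g : Vector (Fin n) k} → (∀ j → g j ≢ x) →
  Injective _≡_ _≡_ g → Injective _≡_ _≡_ (x ∷ g)
Injective-∷ g∌x inj {zero}  {zero}  _  = refl
Injective-∷ g∌x inj {zero}  {suc j} eq = ⊥-elim (g∌x j (sym eq))
Injective-∷ g∌x inj {suc i} {zero}  eq = ⊥-elim (g∌x i eq)
Injective-∷ g∌x inj {suc i} {suc j} eq = cong suc (inj eq)

Injective-removeAt : {f : Vector (Fin n) (suc k)} → Injective _≡_ _≡_ f →
  (i : Fin (suc k)) → Injective _≡_ _≡_ (removeAt f i)
Injective-removeAt inj i eq = FinP.punchIn-injective i _ _ (inj eq)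

removeAt-∌ : {f : Vector (Fin n) (suc k)} → Injective _≡_ _≡_ f →
  ∀ i j → removeAt f i j ≢ f i
removeAt-∌ inj i j eq = FinP.punchInᵢ≢i i j (inj eq)

Injective-moveToFront : {f : Vector (Fin n) (suc k)} → Injective _≡_ _≡_ f →
  (i : Fin (suc k)) → Injective _≡_ _≡_ (moveToFront f i)
Injective-moveToFront inj i = Injective-∷ (removeAt-∌ inj i) (Injective-removeAt inj i)

removeAt-avoiding : (f : Vector (Fin n) (suc k)) → Injective _≡_ _≡_ f →
  (x : Fin n) → ∃ λ i → ∀ j → removeAt f i j ≢ x
removeAt-avoiding f inj x with FinP.any? (λ i → f i FinP.≟ x)
... | yes (i , fi≡x) = i , λ j eq → removeAt-∌ inj i j (trans eq (sym fi≡x))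
... | no  f∌x        = zero , λ j eq → f∌x (suc j , eq)

HasRank-unique : {M : Matrix n} {r r′ : ℕ} → HasRank M r → HasRank M r′ → r ≡ r′
HasRank-unique ((f , injf , indf) , maximal) ((f′ , injf′ , indf′) , maximal′) =
  ℕP.≤-antisym (maximal′ _ f injf indf) (maximal _ f′ injf′ indf′)

rank-basis-spans : {M : Matrix n} {r : ℕ} → HasRank M r →
  (S : Vector (Fin n) r) → Injective _≡_ _≡_ S → Independent (M ∘ S) →
  (u : Fin n) → (∀ j → S j ≢ u) → ¬ ¬ (M u ∈Span (M ∘ S))
rank-basis-spans (_ , maximal) S injS indS u S∌u u∉span =
  ℕP.<-irrefl refl (maximal _ (u ∷ S) (Injective-∷ S∌u injS) (∉Span⇒Independent-∷ indS u∉span))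

module RowUpdate (M : Matrix n) (N : ℚ → Matrix n) (a₀ : ℚ) (P Q : Fin n) (dP dQ : Vector ℚ n)
  (row-P : ∀ x → N x P ≗ M P +ᵛ (x - a₀) ·ᵛ dP)
  (row-Q : ∀ x → N x Q ≗ M Q +ᵛ (x - a₀) ·ᵛ dQ)
  (row-other : ∀ x u → u ≢ P → u ≢ Q → N x u ≗ M u)
  {r : ℕ} (rankM : HasRank M r)
  where

  avoiding-bound : ∀ x (g : Vector (Fin n) k) → Injective _≡_ _≡_ g →
    (∀ j → g j ≢ P) → (∀ j → g j ≢ Q) → Independent (N x ∘ g) → k ≤ r
  avoiding-bound x g inj g∌P g∌Q ind =
    proj₂ rankM _ g inj (Independent-cong (λ i → row-other x (g i) (g∌P i) (g∌Q i)) ind)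

  rank≤2+r : ∀ x k (g : Vector (Fin n) k) → Injective _≡_ _≡_ g → Independent (N x ∘ g) →
    k ≤ 2 + r
  rank≤2+r x zero          _ _   _   = z≤n
  rank≤2+r x (suc zero)    _ _   _   = s≤s z≤n
  rank≤2+r x (suc (suc k)) g inj ind =
    s≤s (s≤s (avoiding-bound x (removeAt g′ iQ) (Injective-removeAt inj′ iQ)
                (λ j → g′∌P (punchIn iQ j)) g″∌Q
                (Independent-removeAt {v = N x ∘ g′} iQ (Independent-removeAt {v = N x ∘ g} iP ind))))
    where
    iP = proj₁ (removeAt-avoiding g inj P)
    g′∌P = proj₂ (removeAt-avoiding g inj P)
    g′ = removeAt g iP
    inj′ = Injective-removeAt inj iP
    iQ = proj₁ (removeAt-avoiding g′ inj′ Q)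
    g″∌Q = proj₂ (removeAt-avoiding g′ inj′ Q)

  module _ {A : ℚ} (g : Vector (Fin n) (2 + r)) (inj : Injective _≡_ _≡_ g)
           (g₀≡P : g zero ≡ P) (g₁≡Q : g (suc zero) ≡ Q) (indA : Independent (N A ∘ g)) where

    private
      S : Vector (Fin n) r
      S = tail (tail g)
      S∌P : ∀ j → S j ≢ P
      S∌P j eq = FinP.0≢1+n (inj (trans g₀≡P (sym eq)))
      S∌Q : ∀ j → S j ≢ Q
      S∌Q j eq = FinP.0≢1+n (FinP.suc-injective (inj (trans g₁≡Q (sym eq))))
      injS : Injective _≡_ _≡_ S
      injS eq = FinP.suc-injective (FinP.suc-injective (inj eq))
      perturbed : ℚ → Vector (Vector ℚ n) (2 + r)
      perturbed x = (M P +ᵛ (x - a₀) ·ᵛ dP) ∷ (M Q +ᵛ (x - a₀) ·ᵛ dQ) ∷ M ∘ S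
      rows : ∀ x i → N x (g i) ≗ perturbed x i
      rows x zero          = λ j → trans (cong (λ u → N x u j) g₀≡P) (row-P x j)
      rows x (suc zero)    = λ j → trans (cong (λ u → N x u j) g₁≡Q) (row-Q x j)
      rows x (suc (suc i)) = row-other x (S i) (S∌P i) (S∌Q i)
      indS : Independent (M ∘ S)
      indS = Independent-cong (λ i j → rows A (suc (suc i)) j)
               (Independent-tail {x = N A (g (suc zero))} {w = N A ∘ S}
                 (Independent-tail {x = N A (g zero)} {w = N A ∘ tail g} indA))

    -- Maximality of rank only yields ¬ ¬ (span membership), enough as independence is ¬¬-stable.
    Independent-transfer : ∀ {x} → x ≢ a₀ → Independent (N x ∘ g)
    Independent-transfer {x} x≢a₀ = Independent-stable {v = N x ∘ g} λ ¬ind →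
      rank-basis-spans {M = M} rankM S injS indS P S∌P λ P∈S →
      rank-basis-spans {M = M} rankM S injS indS Q S∌Q λ Q∈S →
      ¬ind (Independent-cong {v = perturbed x} {w = N x ∘ g} (λ i j → sym (rows x i j))
             (Independent-perturbation {s₀ = A - a₀} P∈S Q∈S (x≢y⇒x-y≢0 x≢a₀)
               (Independent-cong {v = N A ∘ g} {w = perturbed A} (rows A) indA)))

  HasRank-preserved : ∀ {A} → HasRank (N A) (2 + r) → ∀ {x} → x ≢ a₀ → HasRank (N x) (2 + r)
  HasRank-preserved {A} ((f , inj , ind) , _) {x} x≢a₀ = lower , rank≤2+r x
    where
    lower : Σ (Vector (Fin n) (2 + r)) λ g → Injective _≡_ _≡_ g × Independent (N x ∘ g)
    lower with FinP.any? (λ i → f i FinP.≟ Q)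
    ... | no f∌Q = ⊥-elim (ℕP.<-irrefl refl
            (avoiding-bound A (removeAt f iP) (Injective-removeAt inj iP) f′∌P
              (λ j → f∌Q ∘ (punchIn iP j ,_)) (Independent-removeAt {v = N A ∘ f} iP ind)))
      where
      iP = proj₁ (removeAt-avoiding f inj P)
      f′∌P = proj₂ (removeAt-avoiding f inj P)
    ... | yes (iQ , fiQ≡Q) with FinP.any? (λ j → removeAt f iQ j FinP.≟ P)
    ...   | no f′∌P = ⊥-elim (ℕP.<-irrefl refl
              (avoiding-bound A (removeAt f iQ) (Injective-removeAt inj iQ)
                (λ j → f′∌P ∘ (j ,_)) (λ j eq → removeAt-∌ inj iQ j (trans eq (sym fiQ≡Q)))
                (Independent-removeAt {v = N A ∘ f} iQ ind)))
    ...   | yes (iP , f′iP≡P) = g , injg , Independent-transfer g injg f′iP≡P fiQ≡Q indg x≢a₀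
      where
      g = moveToFront (moveToFront f iQ) (suc iP)
      injg = Injective-moveToFront (Injective-moveToFront inj iQ) (suc iP)
      indg = Independent-moveToFront {v = N A ∘ moveToFront f iQ} (suc iP)
               (Independent-moveToFront {v = N A ∘ f} iQ ind)

unitVector : Fin n → Vector ℚ n
unitVector i j with j FinP.≟ i
... | yes _ = 1ℚ
... | no  _ = 0ℚ

tutte-cong : (G : SimpleGraph n) (w w′ : Evaluation n) (u v : Fin n) →
  w u v ≡ w′ u v → w v u ≡ w′ v u → tutte G w u v ≡ tutte G w′ u v
tutte-cong G w w′ u v wuv≡ wvu≡ with adj G u v
... | false = refl
... | true with u FinP.<? v
...   | yes _ = wuv≡
...   | no  _ with v FinP.<? u
...     | yes _ = cong -_ wvu≡
...     | no  _ = refl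

module EdgeUpdate (G : SimpleGraph n) (val : Evaluation n) (e : Edge G) where

  private
    P Q : Fin n
    P = p e
    Q = q e
    a₀ : ℚ
    a₀ = valueAt val e

    P≢Q : P ≢ Q
    P≢Q eq = FinP.<-irrefl eq (p<q e)

    setVar-off : ∀ x u v → ¬ (u ≡ P × v ≡ Q) → setVar val e x u v ≡ val u v
    setVar-off x u v ¬uv≡PQ with u FinP.≟ P | v FinP.≟ Q
    ... | yes u≡P | yes v≡Q = ⊥-elim (¬uv≡PQ (u≡P , v≡Q))
    ... | yes _   | no  _   = refl
    ... | no  _   | _       = refl

    setVar-on : ∀ x → setVar val e x P Q ≡ x
    setVar-on x with P FinP.≟ P | Q FinP.≟ Q
    ... | yes _ | yes _   = refl
    ... | yes _ | no  Q≢Q = ⊥-elim (Q≢Q refl)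
    ... | no P≢P | _      = ⊥-elim (P≢P refl)

    tutte-PQ : ∀ w → tutte G w P Q ≡ w P Q
    tutte-PQ w with adj G P Q | isAdj e
    ... | true | refl with P FinP.<? Q
    ...   | yes _   = refl
    ...   | no  P≮Q = ⊥-elim (P≮Q (p<q e))

    tutte-QP : ∀ w → tutte G w Q P ≡ - w P Q
    tutte-QP w with adj G Q P | trans (symm G Q P) (isAdj e)
    ... | true | refl with Q FinP.<? P
    ...   | yes Q<P = ⊥-elim (FinP.<-asym Q<P (p<q e))
    ...   | no  _ with P FinP.<? Q
    ...     | yes _   = refl
    ...     | no  P≮Q = ⊥-elim (P≮Q (p<q e))

  row-other : ∀ x u → u ≢ P → u ≢ Q → tutte G (setVar val e x) u ≗ tutte G val u
  row-other x u u≢P u≢Q v = tutte-cong G _ _ u v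
    (setVar-off x u v (u≢P ∘ proj₁)) (setVar-off x v u (u≢Q ∘ proj₂))

  row-p : ∀ x → tutte G (setVar val e x) P ≗ tutte G val P +ᵛ (x - a₀) ·ᵛ unitVector Q
  row-p x v with v FinP.≟ Q
  ... | yes refl = begin
    tutte G (setVar val e x) P Q   ≡⟨ tutte-PQ _ ⟩
    setVar val e x P Q             ≡⟨ setVar-on x ⟩
    x                              ≡⟨ solve 2 (λ x a → x := a :+ (x :- a) :* con 1ℚ) refl x a₀ ⟩
    a₀ +ℚ (x - a₀) * 1ℚ            ≡⟨ cong (_+ℚ (x - a₀) * 1ℚ) (sym (tutte-PQ val)) ⟩
    tutte G val P Q +ℚ (x - a₀) * 1ℚ ∎
    where open ≡-Reasoning
  ... | no v≢Q = trans
    (tutte-cong G _ _ P v (setVar-off x P v (v≢Q ∘ proj₂)) (setVar-off x v P (P≢Q ∘ proj₂)))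
    (solve 2 (λ m s → m := m :+ s :* con 0ℚ) refl (tutte G val P v) (x - a₀))

  row-q : ∀ x → tutte G (setVar val e x) Q ≗ tutte G val Q +ᵛ (x - a₀) ·ᵛ map -_ (unitVector P)
  row-q x v with v FinP.≟ P
  ... | yes refl = begin
    tutte G (setVar val e x) Q P     ≡⟨ tutte-QP _ ⟩
    - setVar val e x P Q             ≡⟨ cong -_ (setVar-on x) ⟩
    - x                              ≡⟨ solve 2 (λ x a → :- x := :- a :+ (x :- a) :* (:- con 1ℚ)) refl x a₀ ⟩
    - a₀ +ℚ (x - a₀) * - 1ℚ          ≡⟨ cong (_+ℚ (x - a₀) * - 1ℚ) (sym (tutte-QP val)) ⟩
    tutte G val Q P +ℚ (x - a₀) * - 1ℚ ∎
    where open ≡-Reasoning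
  ... | no v≢P = trans
    (tutte-cong G _ _ Q v (setVar-off x Q v (P≢Q ∘ sym ∘ proj₁)) (setVar-off x v Q (v≢P ∘ proj₁)))
    (solve 2 (λ m s → m := m :+ s :* (:- con 0ℚ)) refl (tutte G val Q v) (x - a₀))

-- The bounds 1 ≤ a ≤ n¹⁰ play no role: any value a of x_e witnessing the rank jump will do.
lemma3p5 : (n : ℕ) (G : SimpleGraph n) (val : Evaluation n) (e : Edge G)
    → (Σ ℕ λ a → (1 ≤ a) × (a ≤ n ^ 10)
         × (Σ ℕ λ r → HasRank (tutte G val) r
              × HasRank (tutte G (setVar val e (+ a Q./ 1))) (r + 2)))
    → (ã : ℚ) → ¬ (ã ≡ valueAt val e)
    → (r : ℕ) → HasRank (tutte G val) r
    → HasRank (tutte G (setVar val e ã)) (r + 2)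
lemma3p5 n G val e (a , _ , _ , r₀ , rank₀ , rankₐ) ã ã≢a₀ r rank =
  subst (HasRank (tutte G (setVar val e ã))) (ℕP.+-comm 2 r) (HasRank-preserved rankₐ′ ã≢a₀)
  where
  open EdgeUpdate G val e
  open RowUpdate (tutte G val) (λ x → tutte G (setVar val e x)) (valueAt val e) (p e) (q e)
                 (unitVector (q e)) (map -_ (unitVector (p e))) row-p row-q row-other rank
  rankₐ′ : HasRank (tutte G (setVar val e (+ a Q./ 1))) (2 + r)
  rankₐ′ = subst (HasRank (tutte G (setVar val e (+ a Q./ 1))))
                 (trans (cong (_+ 2) (HasRank-unique {M = tutte G val} rank₀ rank)) (ℕP.+-comm r 2)) rankₐ
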